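{- For any identity $\varphi \approx \psi$ of type $\langle 2,1\rangle$ (binary $\lor$, unary $\lnot$), the following are equivalent: (1) $\mathbf{IS}_3 \vDash \varphi \approx \psi$; (2) $\mathcal{BISL} \vDash \varphi \approx \psi$; (3) $\varphi \approx \psi$ is bipolarly balanced.
   Context: An involutive semilattice is an algebra $\langle I,\lor,\lnot\rangle$ of type $\langle 2,1\rangle$ where $\langle I,\lor\rangle$ is a semilattice and $\lnot\lnot x\approx x$, $\lnot(x\lor y)\approx \lnot x\lor\lnot y$ hold; $\mathcal{ISL}$ is the variety of involutive semilattices. $\mathcal{BISL}$ is the subvariety of $\mathcal{ISL}$ axiomatised (relative to $\mathcal{ISL}$) by $x\lor\lnot x\approx (x\lor \lnot x)\lor y$. $\mathbf{IS}_3$ is the 3-element involutive semilattice with universe $\{\mathbf{i},\lnot\mathbf{i},\mathbf{j}\}$, where $\mathbf{i}\neq\lnot\mathbf{i}$, $\lnot\mathbf{j}=\mathbf{j}$, $\mathbf{j}$ is the top element and $\mathbf{i}\lor\lnot\mathbf{i}=\mathbf{j}$. For a term $\varphi$, $Var^{+}(\varphi)$ (resp. $Var^{ - }(\varphi)$) is the set of variables having an occurrence in $\varphi$ within the scope of an even (resp. odd) number of occurrences of $\lnot$. An identity $\varphi\approx\psi$ is balanced regular if $Var^+(\varphi)=Var^+(\psi)$ and $Var^-(\varphi)=Var^-(\psi)$; it is bipolar if $Var^+(\varphi)\cap Var^-(\varphi)\neq\emptyset$ and $Var^+(\psi)\cap Var^-(\psi)\neq\emptyset$; it is bipolarly balanced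 if it is bipolar or balanced regular. -}

module Defs where

open import Data.Nat using (ℕ)
open import Data.Bool using (Bool; true; false; not)
open import Data.Product using (_×_; ∃; _,_)
open import Data.Sum using (_⊎_)
open import Relation.Binary.PropositionalEquality using (_≡_)
open import Function.Bundles using (_⇔_)
import Algebra.Lattice.Structures as LS

infixr 6 _∨'_
data Term : Set where
  var   : ℕ → Term
  _∨'_  : Term → Term → Term
  ¬'_   : Term → Term

Identity : Set
Identity = Term × Term

record BISLAlg : Set₁ where
  field
    Carrier        : Set
    _∨_            : Carrier → Carrier → Carrier
    ¬_             : Carrier → Carrier
    isSemilattice  : LS.IsSemilattice {A = Carrier} _≡_ _∨_
    ¬¬-invol       : ∀ x → ¬ (¬ x) ≡ x
    ¬-distrib-∨    : ∀ x y → ¬ (x ∨ y) ≡ (¬ x) ∨ (¬ y)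
    bounded        : ∀ x y → x ∨ (¬ x) ≡ (x ∨ (¬ x)) ∨ y

module _ {C : Set} (join : C → C → C) (neg : C → C) where
  evalWith : (ℕ → C) → Term → C
  evalWith ρ (var x)   = ρ x
  evalWith ρ (t ∨' s)  = join (evalWith ρ t) (evalWith ρ s)
  evalWith ρ (¬' t)    = neg (evalWith ρ t)

_⊨BISL_ : BISLAlg → Identity → Set
A ⊨BISL (φ , ψ) = ∀ (ρ : ℕ → Carrier) → evalWith _∨_ ¬_ ρ φ ≡ evalWith _∨_ ¬_ ρ ψ
  where open BISLAlg A

BISL⊨ : Identity → Set₁
BISL⊨ e = ∀ (A : BISLAlg) → A ⊨BISL e

data IS3 : Set where
  𝐢 ¬𝐢 𝐣 : IS3

_∨₃_ : IS3 → IS3 → IS3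
𝐢  ∨₃ 𝐢  = 𝐢
¬𝐢 ∨₃ ¬𝐢 = ¬𝐢
_  ∨₃ _  = 𝐣

¬₃ : IS3 → IS3
¬₃ 𝐢  = ¬𝐢
¬₃ ¬𝐢 = 𝐢
¬₃ 𝐣  = 𝐣

IS3⊨ : Identity → Set
IS3⊨ (φ , ψ) = ∀ (ρ : ℕ → IS3) → evalWith _∨₃_ ¬₃ ρ φ ≡ evalWith _∨₃_ ¬₃ ρ ψ

-- OccAt b x t : variable x has an occurrence in t within the scope of an
-- even (b = true) / odd (b = false) number of occurrences of ¬.
data OccAt : Bool → ℕ → Term → Set where
  here : ∀ {x} → OccAt true x (var x)
  inl  : ∀ {b x t s} → OccAt b x t → OccAt b x (t ∨' s)
  inr  : ∀ {b x t s} → OccAt b x s → OccAt b x (t ∨' s)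
  neg  : ∀ {b x t} → OccAt b x t → OccAt (not b) x (¬' t)

_∈Var⁺_ : ℕ → Term → Set
x ∈Var⁺ t = OccAt true x t

_∈Var⁻_ : ℕ → Term → Set
x ∈Var⁻ t = OccAt false x t

BalancedRegular : Identity → Set
BalancedRegular (φ , ψ) =
  (∀ x → (x ∈Var⁺ φ) ⇔ (x ∈Var⁺ ψ)) × (∀ x → (x ∈Var⁻ φ) ⇔ (x ∈Var⁻ ψ))

HasBipolarVar : Term → Set
HasBipolarVar t = ∃ λ x → (x ∈Var⁺ t) × (x ∈Var⁻ t)

Bipolar : Identity → Set
Bipolar (φ , ψ) = HasBipolarVar φ × HasBipolarVar ψ

BipolarlyBalanced : Identity → Set
BipolarlyBalanced e = Bipolar e ⊎ BalancedRegular e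

-- In an involutive semilattice the value of a term is the join of its
-- literals (x for a positive, ¬ x for a negative occurrence of x), so
-- balanced regular identities hold everywhere.  In BISL every a ∨ ¬ a is the
-- top element, so a term with a bipolar variable always evaluates to the top
-- and bipolar identities hold as well.  Conversely, in IS₃ a bipolar term
-- always evaluates to 𝐣, while a term ψ without bipolar variables evaluates to
-- 𝐢 under an assignment sending all of its literals to 𝐢; that assignment
-- sends every literal missing from ψ to ¬𝐢, which separates ψ from any term in
-- which that literal occurs.
module Submission where

open import Defs
open import Data.Product using (_×_; _,_)
open import Function.Bundles using (_⇔_)

open import Algebra.Lattice.Bundles using (Semilattice)
open import Algebra.Lattice.Properties.Semilattice using (∧-orderTheoreticJoinSemilattice)
open import Algebra.Lattice.Structures using (IsSemilattice)
open import Data.Bool using (Bool; true; false; not; if_then_else_)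
open import Data.Bool.Properties using (not-involutive)
open import Data.Empty using (⊥-elim)
open import Data.List using (List; []; _∷_; _++_)
open import Data.List.Membership.Propositional using (_∈_; lose)
open import Data.List.Membership.Propositional.Properties using (∈-++⁺ˡ; ∈-++⁺ʳ)
open import Data.List.Relation.Unary.Any using (here; any?; satisfied)
open import Data.Nat using (ℕ; _≟_)
open import Data.Sum using (inj₁; inj₂)
open import Function.Bundles using (mk⇔; Equivalence)
open import Relation.Binary.PropositionalEquality
  using (_≡_; _≢_; refl; sym; trans; cong; cong₂; subst; isEquivalence; module ≡-Reasoning)
open import Relation.Nullary using (Dec; yes; no; ¬_)
open import Relation.Nullary.Decidable
  using (does; map′; _×-dec_; _⊎-dec_; dec-true; dec-false; decidable-stable)
import Relation.Binary.Lattice as Lattice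

_⊆ₒ_ : Term → Term → Set
t ⊆ₒ s = ∀ {b x} → OccAt b x t → OccAt b x s

balancedRegular⇔⊆ₒ : ∀ {φ ψ} → BalancedRegular (φ , ψ) ⇔ (φ ⊆ₒ ψ × ψ ⊆ₒ φ)
balancedRegular⇔⊆ₒ = mk⇔
  (λ (f⁺ , f⁻) →
    (λ { {true} → Equivalence.to (f⁺ _) ; {false} → Equivalence.to (f⁻ _) }) ,
    (λ { {true} → Equivalence.from (f⁺ _) ; {false} → Equivalence.from (f⁻ _) }))
  (λ (φ⊆ψ , ψ⊆φ) → (λ _ → mk⇔ φ⊆ψ ψ⊆φ) , (λ _ → mk⇔ φ⊆ψ ψ⊆φ))

module InvolutiveSemilattice
  {I : Set} {_∨_ : I → I → I} {∼_ : I → I}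
  (isSemilattice : IsSemilattice _≡_ _∨_)
  (∼-involutive : ∀ a → ∼ (∼ a) ≡ a)
  (∼-distrib-∨ : ∀ a c → ∼ (a ∨ c) ≡ (∼ a) ∨ (∼ c))
  where

  private
    semilattice : Semilattice _ _
    semilattice = record { isSemilattice = isSemilattice }

  -- a ≤ c unfolds to c ≡ c ∨ a.
  open Lattice.JoinSemilattice (∧-orderTheoreticJoinSemilattice semilattice) public
    using (_≤_; antisym; x≤x∨y; y≤x∨y; ∨-least)
    renaming (refl to ≤-refl; reflexive to ≤-reflexive; trans to ≤-trans)

  ∼-mono-≤ : ∀ {a c} → a ≤ c → ∼ a ≤ ∼ c
  ∼-mono-≤ {a} {c} c≡c∨a = trans (cong ∼_ c≡c∨a) (∼-distrib-∨ c a)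

  ∼ˡ-≤⇒≤-∼ʳ : ∀ {a c} → ∼ a ≤ c → a ≤ ∼ c
  ∼ˡ-≤⇒≤-∼ʳ {a} {c} h = subst (_≤ ∼ c) (∼-involutive a) (∼-mono-≤ h)

  ≤-∼ʳ⇒∼ˡ-≤ : ∀ {a c} → a ≤ ∼ c → ∼ a ≤ c
  ≤-∼ʳ⇒∼ˡ-≤ {a} {c} h = subst (∼ a ≤_) (∼-involutive c) (∼-mono-≤ h)

  signed : Bool → I → I
  signed true  a = a
  signed false a = ∼ a

  ∼-signed : ∀ b a → ∼ (signed b a) ≡ signed (not b) a
  ∼-signed true  a = refl
  ∼-signed false a = ∼-involutive a

  signed-involutive : ∀ b a → signed b (signed b a) ≡ a
  signed-involutive true  a = refl
  signed-involutive false a = ∼-involutive a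

  module _ (ρ : ℕ → I) where

    ⟦_⟧ : Term → I
    ⟦_⟧ = evalWith _∨_ ∼_ ρ

    literal-≤-⟦⟧ : ∀ {b x t} → OccAt b x t → signed b (ρ x) ≤ ⟦ t ⟧
    literal-≤-⟦⟧ here = ≤-refl
    literal-≤-⟦⟧ (inl {t = t} {s} p) = ≤-trans (literal-≤-⟦⟧ p) (x≤x∨y ⟦ t ⟧ ⟦ s ⟧)
    literal-≤-⟦⟧ (inr {t = t} {s} p) = ≤-trans (literal-≤-⟦⟧ p) (y≤x∨y ⟦ t ⟧ ⟦ s ⟧)
    literal-≤-⟦⟧ (neg {b} {x} p) =
      subst (_≤ _) (∼-signed b (ρ x)) (∼-mono-≤ (literal-≤-⟦⟧ p))

    ⟦⟧-least : ∀ {c} t → (∀ {b x} → OccAt b x t → signed b (ρ x) ≤ c) → ⟦ t ⟧ ≤ c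
    ⟦⟧-least (var x)  below = below here
    ⟦⟧-least (t ∨' s) below =
      ∨-least (⟦⟧-least t (λ p → below (inl p))) (⟦⟧-least s (λ p → below (inr p)))
    ⟦⟧-least (¬' t)   below = ≤-∼ʳ⇒∼ˡ-≤ (⟦⟧-least t λ {b} {x} p →
      ∼ˡ-≤⇒≤-∼ʳ (subst (_≤ _) (sym (∼-signed b (ρ x))) (below (neg p))))

    ⟦⟧-mono-⊆ₒ : ∀ {t s} → t ⊆ₒ s → ⟦ t ⟧ ≤ ⟦ s ⟧
    ⟦⟧-mono-⊆ₒ {t} t⊆s = ⟦⟧-least t (λ p → literal-≤-⟦⟧ (t⊆s p))

    ⟦⟧-cong-⊆ₒ : ∀ {t s} → t ⊆ₒ s → s ⊆ₒ t → ⟦ t ⟧ ≡ ⟦ s ⟧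
    ⟦⟧-cong-⊆ₒ t⊆s s⊆t = antisym (⟦⟧-mono-⊆ₒ t⊆s) (⟦⟧-mono-⊆ₒ s⊆t)

module BISL (A : BISLAlg) where
  open BISLAlg A renaming (¬_ to ∼_)
  open InvolutiveSemilattice isSemilattice ¬¬-invol ¬-distrib-∨ public

  ≤-x∨∼x : ∀ a x → a ≤ x ∨ (∼ x)
  ≤-x∨∼x a x = bounded x a

  x∨∼x-unique : ∀ x y → x ∨ (∼ x) ≡ y ∨ (∼ y)
  x∨∼x-unique x y = antisym (≤-x∨∼x (x ∨ (∼ x)) y) (≤-x∨∼x (y ∨ (∼ y)) x)

  ⟦bipolar⟧≡ : ∀ ρ {t} → ((x , _) : HasBipolarVar t) → ⟦ ρ ⟧ t ≡ ρ x ∨ (∼ ρ x)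
  ⟦bipolar⟧≡ ρ {t} (x , p⁺ , p⁻) =
    antisym (≤-x∨∼x (⟦ ρ ⟧ t) (ρ x)) (∨-least (literal-≤-⟦⟧ ρ p⁺) (literal-≤-⟦⟧ ρ p⁻))

  ⟦bipolar⟧≡⟦bipolar⟧ : ∀ ρ {t s} → HasBipolarVar t → HasBipolarVar s → ⟦ ρ ⟧ t ≡ ⟦ ρ ⟧ s
  ⟦bipolar⟧≡⟦bipolar⟧ ρ bt@(x , _) bs@(y , _) =
    trans (⟦bipolar⟧≡ ρ bt) (trans (x∨∼x-unique (ρ x) (ρ y)) (sym (⟦bipolar⟧≡ ρ bs)))

bipolarlyBalanced⇒BISL⊨ : ∀ φ ψ → BipolarlyBalanced (φ , ψ) → BISL⊨ (φ , ψ)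
bipolarlyBalanced⇒BISL⊨ φ ψ (inj₁ (bφ , bψ)) A ρ = BISL.⟦bipolar⟧≡⟦bipolar⟧ A ρ bφ bψ
bipolarlyBalanced⇒BISL⊨ φ ψ (inj₂ br) A ρ =
  let φ⊆ψ , ψ⊆φ = Equivalence.to balancedRegular⇔⊆ₒ br in BISL.⟦⟧-cong-⊆ₒ A ρ φ⊆ψ ψ⊆φ

occ-¬'⁺ : ∀ {b x t} → OccAt (not b) x t → OccAt b x (¬' t)
occ-¬'⁺ {b} {x} {t} p = subst (λ c → OccAt c x (¬' t)) (not-involutive b) (neg p)

occ-¬'⁻ : ∀ {b x t} → OccAt b x (¬' t) → OccAt (not b) x t
occ-¬'⁻ {x = x} {t} (neg {b} p) = subst (λ c → OccAt c x t) (sym (not-involutive b)) p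

occ? : ∀ b x t → Dec (OccAt b x t)
occ? true  x (var y)  = map′ (λ { refl → here }) (λ { here → refl }) (x ≟ y)
occ? false x (var y)  = no λ ()
occ? b     x (t ∨' s) =
  map′ (λ { (inj₁ p) → inl p ; (inj₂ p) → inr p }) (λ { (inl p) → inj₁ p ; (inr p) → inj₂ p })
       (occ? b x t ⊎-dec occ? b x s)
occ? b     x (¬' t)   = map′ occ-¬'⁺ occ-¬'⁻ (occ? (not b) x t)

vars : Term → List ℕ
vars (var x)  = x ∷ []
vars (t ∨' s) = vars t ++ vars s
vars (¬' t)   = vars t

occ⇒∈vars : ∀ {b x t} → OccAt b x t → x ∈ vars t
occ⇒∈vars here = here refl
occ⇒∈vars (inl p) = ∈-++⁺ˡ (occ⇒∈vars p)
occ⇒∈vars (inr {t = t} p) = ∈-++⁺ʳ (vars t) (occ⇒∈vars p)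
occ⇒∈vars (neg p) = occ⇒∈vars p

hasBipolarVar? : ∀ t → Dec (HasBipolarVar t)
hasBipolarVar? t =
  map′ satisfied (λ (x , p⁺ , p⁻) → lose (occ⇒∈vars p⁺) (p⁺ , p⁻))
       (any? (λ x → occ? true x t ×-dec occ? false x t) (vars t))

∨₃-assoc : ∀ a b c → (a ∨₃ b) ∨₃ c ≡ a ∨₃ (b ∨₃ c)
∨₃-assoc 𝐣  b  c  = refl
∨₃-assoc 𝐢  𝐣  c  = refl
∨₃-assoc ¬𝐢 𝐣  c  = refl
∨₃-assoc 𝐢  𝐢  𝐢  = refl
∨₃-assoc 𝐢  𝐢  ¬𝐢 = refl
∨₃-assoc 𝐢  𝐢  𝐣  = refl
∨₃-assoc 𝐢  ¬𝐢 𝐢  = refl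
∨₃-assoc 𝐢  ¬𝐢 ¬𝐢 = refl
∨₃-assoc 𝐢  ¬𝐢 𝐣  = refl
∨₃-assoc ¬𝐢 𝐢  𝐢  = refl
∨₃-assoc ¬𝐢 𝐢  ¬𝐢 = refl
∨₃-assoc ¬𝐢 𝐢  𝐣  = refl
∨₃-assoc ¬𝐢 ¬𝐢 𝐢  = refl
∨₃-assoc ¬𝐢 ¬𝐢 ¬𝐢 = refl
∨₃-assoc ¬𝐢 ¬𝐢 𝐣  = refl

∨₃-comm : ∀ a b → a ∨₃ b ≡ b ∨₃ a
∨₃-comm 𝐢  𝐢  = refl
∨₃-comm 𝐢  ¬𝐢 = refl
∨₃-comm 𝐢  𝐣  = refl
∨₃-comm ¬𝐢 𝐢  = refl
∨₃-comm ¬𝐢 ¬𝐢 = refl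
∨₃-comm ¬𝐢 𝐣  = refl
∨₃-comm 𝐣  b  = sym (b∨₃𝐣 b)
  where
  b∨₃𝐣 : ∀ b → b ∨₃ 𝐣 ≡ 𝐣
  b∨₃𝐣 𝐢  = refl
  b∨₃𝐣 ¬𝐢 = refl
  b∨₃𝐣 𝐣  = refl

∨₃-idem : ∀ a → a ∨₃ a ≡ a
∨₃-idem 𝐢  = refl
∨₃-idem ¬𝐢 = refl
∨₃-idem 𝐣  = refl

¬₃-involutive : ∀ a → ¬₃ (¬₃ a) ≡ a
¬₃-involutive 𝐢  = refl
¬₃-involutive ¬𝐢 = refl
¬₃-involutive 𝐣  = refl

¬₃-distrib-∨₃ : ∀ a b → ¬₃ (a ∨₃ b) ≡ ¬₃ a ∨₃ ¬₃ b
¬₃-distrib-∨₃ 𝐢  𝐢  = refl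
¬₃-distrib-∨₃ 𝐢  ¬𝐢 = refl
¬₃-distrib-∨₃ 𝐢  𝐣  = refl
¬₃-distrib-∨₃ ¬𝐢 𝐢  = refl
¬₃-distrib-∨₃ ¬𝐢 ¬𝐢 = refl
¬₃-distrib-∨₃ ¬𝐢 𝐣  = refl
¬₃-distrib-∨₃ 𝐣  b  = refl

a∨₃¬₃a≡𝐣 : ∀ a → a ∨₃ ¬₃ a ≡ 𝐣
a∨₃¬₃a≡𝐣 𝐢  = refl
a∨₃¬₃a≡𝐣 ¬𝐢 = refl
a∨₃¬₃a≡𝐣 𝐣  = refl

IS3-BISL : BISLAlg
IS3-BISL = record
  { Carrier       = IS3
  ; _∨_           = _∨₃_
  ; ¬_            = ¬₃
  ; isSemilattice = record
    { isBand = record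
      { isSemigroup = record
        { isMagma = record { isEquivalence = isEquivalence ; ∙-cong = cong₂ _∨₃_ }
        ; assoc   = ∨₃-assoc
        }
      ; idem = ∨₃-idem
      }
    ; comm = ∨₃-comm
    }
  ; ¬¬-invol      = ¬₃-involutive
  ; ¬-distrib-∨   = ¬₃-distrib-∨₃
  ; bounded       = λ a b → trans (a∨₃¬₃a≡𝐣 a) (cong (_∨₃ b) (sym (a∨₃¬₃a≡𝐣 a)))
  }

module IS₃ = BISL IS3-BISL
open IS₃ using (_≤_; ⟦_⟧; signed)

≤𝐢⇒≡𝐢 : ∀ {a} → a ≤ 𝐢 → a ≡ 𝐢
≤𝐢⇒≡𝐢 {𝐢}  _  = refl
≤𝐢⇒≡𝐢 {¬𝐢} ()
≤𝐢⇒≡𝐢 {𝐣}  ()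

-- Under separating b ψ the literal of polarity b at y is 𝐢 exactly when it
-- occurs in ψ, and ¬𝐢 otherwise.
separating : Bool → Term → ℕ → IS3
separating b ψ y = signed b (if does (occ? b y ψ) then 𝐢 else ¬𝐢)

separating-occurring : ∀ {b y ψ} → OccAt b y ψ → signed b (separating b ψ y) ≡ 𝐢
separating-occurring {b} {y} {ψ} p rewrite dec-true (occ? b y ψ) p = IS₃.signed-involutive b 𝐢

separating-absent : ∀ {b y ψ} → ¬ OccAt b y ψ → signed b (separating b ψ y) ≡ ¬𝐢
separating-absent {b} {y} {ψ} np rewrite dec-false (occ? b y ψ) np = IS₃.signed-involutive b ¬𝐢

separating-opposite : ∀ {b y ψ} → ¬ OccAt b y ψ → signed (not b) (separating b ψ y) ≡ 𝐢
separating-opposite {b} {y} {ψ} np =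
  trans (sym (IS₃.∼-signed b (separating b ψ y))) (cong ¬₃ (separating-absent np))

⟦nonBipolar⟧-separating≡𝐢 : ∀ b {ψ} → ¬ HasBipolarVar ψ → ⟦ separating b ψ ⟧ ψ ≡ 𝐢
⟦nonBipolar⟧-separating≡𝐢 b {ψ} nbψ =
  ≤𝐢⇒≡𝐢 (IS₃.⟦⟧-least (separating b ψ) ψ (λ p → IS₃.≤-reflexive (literal≡𝐢 b p)))
  where
  literal≡𝐢 : ∀ b {b′ y} → OccAt b′ y ψ → signed b′ (separating b ψ y) ≡ 𝐢
  literal≡𝐢 true  {true}  p  = separating-occurring p
  literal≡𝐢 false {false} p  = separating-occurring p
  literal≡𝐢 true  {false} p⁻ = separating-opposite (λ p⁺ → nbψ (_ , p⁺ , p⁻))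
  literal≡𝐢 false {true}  p⁺ = separating-opposite (λ p⁻ → nbψ (_ , p⁺ , p⁻))

⟦⟧-separating≢𝐢 : ∀ {b x φ ψ} → OccAt b x φ → ¬ OccAt b x ψ → ⟦ separating b ψ ⟧ φ ≢ 𝐢
⟦⟧-separating≢𝐢 p np ⟦φ⟧≡𝐢 = ¬𝐢≢𝐢 (trans (sym (separating-absent np))
  (≤𝐢⇒≡𝐢 (subst (_ ≤_) ⟦φ⟧≡𝐢 (IS₃.literal-≤-⟦⟧ _ p))))
  where
  ¬𝐢≢𝐢 : ¬𝐢 ≢ 𝐢
  ¬𝐢≢𝐢 ()

IS3⊨⇒⊆ₒ : ∀ {φ ψ} → IS3⊨ (φ , ψ) → ¬ HasBipolarVar ψ → φ ⊆ₒ ψ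
IS3⊨⇒⊆ₒ {φ} {ψ} φ≈ψ nbψ {b} {x} p = decidable-stable (occ? b x ψ) λ np →
  ⟦⟧-separating≢𝐢 p np (trans (φ≈ψ (separating b ψ)) (⟦nonBipolar⟧-separating≡𝐢 b nbψ))

IS3⊭bipolar≈nonBipolar : ∀ {φ ψ} → HasBipolarVar φ → ¬ HasBipolarVar ψ → ¬ IS3⊨ (φ , ψ)
IS3⊭bipolar≈nonBipolar {φ} {ψ} bφ@(x , _) nbψ φ≈ψ = 𝐣≢𝐢 (begin
  𝐣                ≡⟨ sym (a∨₃¬₃a≡𝐣 (ρ x)) ⟩
  ρ x ∨₃ ¬₃ (ρ x)  ≡⟨ sym (IS₃.⟦bipolar⟧≡ ρ bφ) ⟩
  ⟦ ρ ⟧ φ          ≡⟨ φ≈ψ ρ ⟩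
  ⟦ ρ ⟧ ψ          ≡⟨ ⟦nonBipolar⟧-separating≡𝐢 true nbψ ⟩
  𝐢                ∎)
  where
  open ≡-Reasoning
  ρ = separating true ψ
  𝐣≢𝐢 : 𝐣 ≢ 𝐢
  𝐣≢𝐢 ()

IS3⊨⇒bipolarlyBalanced : ∀ φ ψ → IS3⊨ (φ , ψ) → BipolarlyBalanced (φ , ψ)
IS3⊨⇒bipolarlyBalanced φ ψ φ≈ψ with hasBipolarVar? φ | hasBipolarVar? ψ
... | yes bφ  | yes bψ  = inj₁ (bφ , bψ)
... | yes bφ  | no  nbψ = ⊥-elim (IS3⊭bipolar≈nonBipolar bφ nbψ φ≈ψ)
... | no  nbφ | yes bψ  = ⊥-elim (IS3⊭bipolar≈nonBipolar bψ nbφ ψ≈φ)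
  where
  ψ≈φ = λ ρ → sym (φ≈ψ ρ)
... | no  nbφ | no  nbψ = inj₂ (Equivalence.from balancedRegular⇔⊆ₒ
  (IS3⊨⇒⊆ₒ φ≈ψ nbψ , IS3⊨⇒⊆ₒ (λ ρ → sym (φ≈ψ ρ)) nbφ))

proposition3p3 : (φ ψ : Term) →
    ((IS3⊨ (φ , ψ) ⇔ BISL⊨ (φ , ψ))
    × (BISL⊨ (φ , ψ) ⇔ BipolarlyBalanced (φ , ψ)))
proposition3p3 φ ψ =
  mk⇔ (λ φ≈ψ → bipolarlyBalanced⇒BISL⊨ φ ψ (IS3⊨⇒bipolarlyBalanced φ ψ φ≈ψ)) BISL⊨⇒IS3⊨ ,
  mk⇔ (λ φ≈ψ → IS3⊨⇒bipolarlyBalanced φ ψ (BISL⊨⇒IS3⊨ φ≈ψ)) (bipolarlyBalanced⇒BISL⊨ φ ψ)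
  where
  BISL⊨⇒IS3⊨ : BISL⊨ (φ , ψ) → IS3⊨ (φ , ψ)
  BISL⊨⇒IS3⊨ φ≈ψ = φ≈ψ IS3-BISL
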